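{- Let $\mathcal T=(T;\leq)$ be a word automatic infinite finitely branching tree. Then there exists an infinite path in $\mathcal T$ whose set of nodes is a regular language.
   Context: A (partial order) tree is a partial order $(T;\leq)$ with a $\leq$-least element (the root) such that for every $x\in T$ the set of $\leq$-predecessors of $x$ is finite and linearly ordered. It is finitely branching if every node has finitely many immediate successors; an infinite path is a maximal linearly ordered infinite subset closed downward. The tree is word automatic if $T$ is a regular set of finite strings over a finite alphabet and $\leq$ is a regular relation (the set of convolutions of pairs in $\leq$ — the two strings read in parallel, the shorter padded at the end with a new symbol — is accepted by a finite automaton). -}

module Defs where

open import Data.Nat using (ℕ)
open import Data.Fin using (Fin)
open import Data.Bool using (Bool; true)
open import Data.Maybe using (Maybe; just; nothing)
open import Data.List using (List; []; _∷_)
open import Data.List.Membership.Propositional using (_∈_; _∉_)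
open import Data.Product using (Σ; ∃; _×_; _,_)
open import Data.Sum using (_⊎_)
open import Relation.Binary.PropositionalEquality using (_≡_; _≢_)
open import Function.Bundles using (_⇔_)
open import Relation.Nullary using (¬_)

record DFA (A : Set) : Set where
  field
    nstates   : ℕ
    start     : Fin nstates
    step      : Fin nstates → A → Fin nstates
    accepting : Fin nstates → Bool

run : {A : Set} (M : DFA A) → Fin (DFA.nstates M) → List A → Fin (DFA.nstates M)
run M s []       = s
run M s (a ∷ w)  = run M (DFA.step M s a) w

Accepts : {A : Set} → DFA A → List A → Set
Accepts M w = DFA.accepting M (run M (DFA.start M) w) ≡ true

Regular : {n : ℕ} → (List (Fin n) → Set) → Set
Regular {n} L = Σ (DFA (Fin n)) λ M → ∀ w → L w ⇔ Accepts M w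

conv : {A : Set} → List A → List A → List (Maybe A × Maybe A)
conv []      []      = []
conv []      (b ∷ v) = (nothing , just b) ∷ conv [] v
conv (a ∷ u) []      = (just a , nothing) ∷ conv u []
conv (a ∷ u) (b ∷ v) = (just a , just b) ∷ conv u v

RegularRel : {n : ℕ} → (List (Fin n) → List (Fin n) → Set) → Set
RegularRel {n} R =
  Σ (DFA (Maybe (Fin n) × Maybe (Fin n))) λ M → ∀ u v → R u v ⇔ Accepts M (conv u v)

FiniteSet : {n : ℕ} → (List (Fin n) → Set) → Set
FiniteSet {n} S = Σ (List (List (Fin n))) λ l → ∀ x → S x → x ∈ l

-- infinite: not contained in any finite list (constructive form of "not finite")
InfiniteSet : {n : ℕ} → (List (Fin n) → Set) → Set
InfiniteSet {n} S = ∀ (l : List (List (Fin n))) → ∃ λ x → S x × x ∉ l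

module _ {n : ℕ} (T : List (Fin n) → Set) (_≤_ : List (Fin n) → List (Fin n) → Set) where

  record IsTree : Set where
    field
      ≤-dom     : ∀ {x y} → x ≤ y → T x × T y
      ≤-refl    : ∀ {x} → T x → x ≤ x
      ≤-antisym : ∀ {x y} → x ≤ y → y ≤ x → x ≡ y
      ≤-trans   : ∀ {x y z} → x ≤ y → y ≤ z → x ≤ z
      root      : List (Fin n)
      root∈T    : T root
      root-least : ∀ {x} → T x → root ≤ x
      preds-finite : ∀ {x} → T x → FiniteSet (λ y → T y × y ≤ x)
      preds-linear : ∀ {x y z} → T x → y ≤ x → z ≤ x → (y ≤ z) ⊎ (z ≤ y)

  ImmSucc : List (Fin n) → List (Fin n) → Set
  ImmSucc x y = T x × T y × x ≤ y × x ≢ y ×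
                (∀ z → T z → x ≤ z → z ≤ y → (z ≡ x) ⊎ (z ≡ y))

  FinitelyBranching : Set
  FinitelyBranching = ∀ x → T x → FiniteSet (ImmSucc x)

  WordAutomatic : Set
  WordAutomatic = Regular T × RegularRel _≤_

  record InfinitePath (P : List (Fin n) → Set) : Set where
    field
      sub      : ∀ x → P x → T x
      linear   : ∀ x y → P x → P y → (x ≤ y) ⊎ (y ≤ x)
      downward : ∀ x y → P y → T x → x ≤ y → P x
      maximal  : ∀ x → T x → (∀ y → P y → (x ≤ y) ⊎ (y ≤ x)) → P x
      infinite : InfiniteSet P

module Submission where

-- Let N be the number of states of an automaton for ≤, and call a node
-- *large* if it has a descendant more than N letters longer than itself.  By
-- pumping, a large node has descendants of every length; hence the root is
-- large (T is infinite) and every large node has a large child (T is finitely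
-- branching).  The leftmost infinite path consists of the large nodes none of
-- whose ancestors has a lexicographically smaller large sibling.  This set is
-- first-order definable from ≤, the lexicographic order and the relation
-- "longer by more than N letters", which are all regular, and relations
-- definable from regular relations are regular.

open import Defs
open import Data.Bool using (Bool; true; false; T; if_then_else_; not; _∧_; _∨_)
open import Data.Bool.Properties using (T-∧; T-∨; T-≡)
open import Data.Empty using (⊥; ⊥-elim)
open import Data.Fin using (Fin; zero; suc; #_; toℕ; fromℕ<; combine; quotient; remainder; funToFin; finToFun)
open import Data.Fin.Properties using (_≟_; remQuot-combine; finToFun-funToFin; pigeonhole; toℕ<n; toℕ-fromℕ<)
  renaming (any? to anyFin?; <-cmp to <-cmpFin; <-asym to <-asymFin; <-irrefl to <-irreflFin;
            <-strictTotalOrder to <-strictTotalOrderFin)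
open import Data.List using (List; []; _∷_; _++_; length; head; take; drop; map; concat; concatMap; replicate; filter; allFin)
open import Data.List.Extrema.Nat using (argmax; f[xs]≤f[argmax])
open import Data.List.Membership.Propositional using (_∈_; find; lose)
open import Data.List.Membership.Propositional.Properties using (∈-map⁺; ∈-concatMap⁺; ∈-allFin)
open import Data.List.Properties
  using (≡-dec; length-++; length-++-≤ˡ; length-++-≤ʳ; length-take; length-drop; take++drop≡id; take-[]; drop-drop; drop-all)
import Data.List.Relation.Binary.Lex.Strict as Lex
open import Data.List.Relation.Binary.Lex.Strict using (base; halt; this; next)
open import Data.List.Relation.Binary.Pointwise using (Pointwise-≡⇒≡)
open import Data.List.Relation.Unary.All using () renaming (lookup to lookupAll)
open import Data.List.Relation.Unary.Any using (Any; here; there; any?)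
open import Data.Maybe using (Maybe; just; nothing)
open import Data.Nat using (ℕ; zero; suc; _+_; _∸_; _*_; _^_; _⊔_; _⊓_; _≤_; _<_; z≤n; s≤s; _≤?_)
open import Data.Nat.Induction using (<-wellFounded)
open import Data.Nat.Properties
  using (≤-refl; ≤-trans; ≤-reflexive; ≤-pred; <⇒≤; <-≤-trans; ≰⇒>; <⇒≱; <-≤-connex; n<1+n; n≤1+n; n≤0⇒n≡0;
         m≤m+n; m≤n+m; m<n+m; +-mono-≤; +-monoʳ-≤; +-monoʳ-<; +-suc; +-identityʳ; suc-injective;
         m+[n∸m]≡n; m+n∸n≡m; m<n⇒0<n∸m; m∸n≢0⇒n<m; ∸-monoˡ-≤; 0∸n≡0; ∸-distribʳ-⊔;
         m≤m⊔n; m≤n⊔m; ⊔-lub; ⊔-identityʳ; ⊓-glb; m⊓n≤n; m≤n⇒m⊓n≡m; m≥n⇒m⊓n≡n; module ≤-Reasoning)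
open import Data.Product using (Σ; ∃; _×_; _,_; proj₁; proj₂)
open import Data.Product.Function.NonDependent.Propositional using (_×-⇔_)
open import Data.Sum using (_⊎_; inj₁; inj₂; [_,_]; swap)
open import Data.Sum.Function.Propositional using (_⊎-⇔_)
open import Data.Unit using (tt)
open import Data.Vec using (Vec; []; _∷_; tabulate; lookup)
open import Data.Vec.Properties using (tabulate-cong; lookup∘tabulate)
open import Data.Vec.Functional as VF using (Vector) renaming (_∷_ to _∷ᵗ_)
open import Function using (_∘_; case_of_)
open import Function.Bundles using (_⇔_; mk⇔; Equivalence)
open import Function.Properties.Equivalence using () renaming (refl to ⇔-refl; trans to ⇔-trans; sym to ⇔-sym)
open import Function.Related.TypeIsomorphisms using (¬-cong-⇔)
open import Induction.WellFounded using (Acc; acc)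
open import Relation.Binary.Bundles using (StrictTotalOrder)
open import Relation.Binary.Definitions using (tri<; tri≈; tri>)
open import Relation.Binary.PropositionalEquality
  using (_≡_; _≢_; refl; sym; trans; cong; cong₂; subst; subst₂; module ≡-Reasoning)
open import Relation.Nullary using (Dec; yes; no; ¬_; ¬?)
open import Relation.Nullary.Decidable using (map′; T?; isYes; toWitness; fromWitness; _×-dec_; _⊎-dec_)

open Equivalence using (to; from)

quotient-combine : ∀ {a b} (i : Fin a) (j : Fin b) → quotient b (combine i j) ≡ i
quotient-combine i j = cong proj₁ (remQuot-combine i j)

remainder-combine : ∀ {a b} (i : Fin a) (j : Fin b) → remainder {a} b (combine i j) ≡ j
remainder-combine i j = cong proj₂ (remQuot-combine i j)

toBit : Bool → Fin 2
toBit false = zero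
toBit true  = suc zero

fromBit : Fin 2 → Bool
fromBit zero    = false
fromBit (suc _) = true

fromBit-toBit : ∀ b → fromBit (toBit b) ≡ b
fromBit-toBit false = refl
fromBit-toBit true  = refl

encodeSet : ∀ {m} → (Fin m → Bool) → Fin (2 ^ m)
encodeSet F = funToFin (toBit ∘ F)

_∈ˢ_ : ∀ {m} → Fin m → Fin (2 ^ m) → Bool
q ∈ˢ s = fromBit (finToFun s q)

∈ˢ-encodeSet : ∀ {m} (F : Fin m → Bool) q → q ∈ˢ encodeSet F ≡ F q
∈ˢ-encodeSet F q = trans (cong fromBit (finToFun-funToFin (toBit ∘ F) q)) (fromBit-toBit (F q))

_^^_ : ∀ {X : Set} → List X → ℕ → List X
y ^^ k = concat (replicate k y)

length-^^ : ∀ {X : Set} (y : List X) k → 0 < length y → k ≤ length (y ^^ k)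
length-^^ y zero    _  = z≤n
length-^^ y (suc k) ne = begin
  suc k                           ≤⟨ +-mono-≤ ne (length-^^ y k ne) ⟩
  length y + length (y ^^ k)      ≡⟨ length-++ y ⟨
  length (y ^^ suc k)             ∎
  where open ≤-Reasoning

drop-++ˡ : ∀ {X : Set} (x v : List X) → drop (length x) (x ++ v) ≡ v
drop-++ˡ []      v = refl
drop-++ˡ (a ∷ x) v = drop-++ˡ x v

module _ {X : Set} (M : DFA X) where
  open DFA M

  run-++ : ∀ s u v → run M s (u ++ v) ≡ run M (run M s u) v
  run-++ s []      v = refl
  run-++ s (a ∷ u) v = run-++ (step s a) u v

  run-^^ : ∀ t y → run M t y ≡ t → ∀ k → run M t (y ^^ k) ≡ t
  run-^^ t y loops zero    = refl
  run-^^ t y loops (suc k) = begin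
    run M t (y ++ y ^^ k)        ≡⟨ run-++ t y (y ^^ k) ⟩
    run M (run M t y) (y ^^ k)   ≡⟨ cong (λ q → run M q (y ^^ k)) loops ⟩
    run M t (y ^^ k)             ≡⟨ run-^^ t y loops k ⟩
    t                            ∎
    where open ≡-Reasoning

  record Loop (s : Fin nstates) (w : List X) : Set where
    field
      pre mid post : List X
      split     : w ≡ pre ++ mid ++ post
      nonempty  : 0 < length mid
      loops     : run M (run M s pre) mid ≡ run M s pre

    pump : ∀ k → run M s (pre ++ mid ^^ k ++ post) ≡ run M s w
    pump k = begin
      run M s (pre ++ mid ^^ k ++ post)                 ≡⟨ run-++ s pre _ ⟩
      run M (run M s pre) (mid ^^ k ++ post)            ≡⟨ run-++ _ (mid ^^ k) post ⟩
      run M (run M (run M s pre) (mid ^^ k)) post       ≡⟨ cong (λ q → run M q post) (run-^^ _ mid loops k) ⟩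
      run M (run M s pre) post                          ≡⟨ cong (λ q → run M q post) loops ⟨
      run M (run M (run M s pre) mid) post              ≡⟨ run-++ _ mid post ⟨
      run M (run M s pre) (mid ++ post)                 ≡⟨ run-++ s pre _ ⟨
      run M s (pre ++ mid ++ post)                      ≡⟨ cong (run M s) split ⟨
      run M s w                                         ∎
      where open ≡-Reasoning

    shorter : length (pre ++ post) < length w
    shorter rewrite split | length-++ pre {post} | length-++ pre {mid ++ post} | length-++ mid {post} =
      +-monoʳ-< (length pre) (m<n+m (length post) nonempty)

  -- Pigeonhole: among the prefixes of length 0 … nstates two reach the same state.
  loop : ∀ s w → nstates < length w → Loop s w
  loop s w long with pigeonhole (n<1+n nstates) (λ (i : Fin (suc nstates)) → run M s (take (toℕ i) w))
  ... | i , j , i<j , same = record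
    { pre = take i′ w ; mid = take d (drop i′ w) ; post = drop d (drop i′ w)
    ; split = sym (trans (cong (take i′ w ++_) (take++drop≡id d (drop i′ w))) (take++drop≡id i′ w))
    ; nonempty = nonempty
    ; loops = begin
        run M (run M s (take i′ w)) (take d (drop i′ w))  ≡⟨ run-++ s (take i′ w) _ ⟨
        run M s (take i′ w ++ take d (drop i′ w))         ≡⟨ cong (run M s) (take-+ i′ d w) ⟨
        run M s (take (i′ + d) w)                         ≡⟨ cong (λ l → run M s (take l w)) (m+[n∸m]≡n (<⇒≤ i<j)) ⟩
        run M s (take (toℕ j) w)                          ≡⟨ same ⟨
        run M s (take i′ w)                               ∎ }
    where
      open ≡-Reasoning
      i′ = toℕ i
      d  = toℕ j ∸ i′
      take-+ : ∀ a b (v : List X) → take (a + b) v ≡ take a v ++ take b (drop a v)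
      take-+ zero    b v       = refl
      take-+ (suc a) b []      = sym (take-[] b)
      take-+ (suc a) b (x ∷ v) = cong (x ∷_) (take-+ a b v)
      nonempty : 0 < length (take d (drop i′ w))
      nonempty rewrite length-take d (drop i′ w) | length-drop i′ w =
        ⊓-glb (m<n⇒0<n∸m i<j)
              (m<n⇒0<n∸m (<-≤-trans i<j (≤-trans (≤-pred (toℕ<n j)) (<⇒≤ long))))

  short-word : ∀ s w → Σ (List X) λ v → length v ≤ nstates × run M s v ≡ run M s w
  short-word s w = go w (<-wellFounded (length w))
    where
      go : ∀ w → Acc _<_ (length w) → Σ (List X) λ v → length v ≤ nstates × run M s v ≡ run M s w
      go w (acc rec) with length w ≤? nstates
      ... | yes short = w , short , refl
      ... | no  long with loop s w (≰⇒> long)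
      ...   | ℓ with go (Loop.pre ℓ ++ Loop.post ℓ) (rec (Loop.shorter ℓ))
      ...     | v , short , same = v , short , trans same (Loop.pump ℓ 0)

wordsUpTo : ∀ n → ℕ → List (List (Fin n))
wordsUpTo n zero    = [] ∷ []
wordsUpTo n (suc L) = [] ∷ concatMap (λ a → map (a ∷_) (wordsUpTo n L)) (allFin n)

wordsUpTo-complete : ∀ {n} (v : List (Fin n)) L → length v ≤ L → v ∈ wordsUpTo n L
wordsUpTo-complete []      zero    _       = here refl
wordsUpTo-complete []      (suc L) _       = here refl
wordsUpTo-complete (a ∷ v) (suc L) (s≤s h) =
  there (∈-concatMap⁺ (λ a → map (a ∷_) (wordsUpTo _ L))
                      (lose (∈-allFin a) (∈-map⁺ (a ∷_) (wordsUpTo-complete v L h))))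

-- Reachability is decidable: it suffices to try the finitely many short words.
reach? : ∀ {n} (M : DFA (Fin n)) (P : Fin (DFA.nstates M) → Set) → (∀ q → Dec (P q)) →
         ∀ s → Dec (Σ (List (Fin n)) λ v → P (run M s v))
reach? {n} M P P? s with any? (λ v → P? (run M s v)) (wordsUpTo n (DFA.nstates M))
... | yes found = let (v , _ , p) = find found in yes (v , p)
... | no none   = no λ (v , p) →
  let (v′ , short , same) = short-word M s v
  in none (lose (wordsUpTo-complete v′ _ short) (subst P (sym same) p))

T-not : ∀ b → T (not b) ⇔ (¬ T b)
T-not true  = mk⇔ (λ ()) (λ ¬t → ¬t tt)
T-not false = mk⇔ (λ _ ()) (λ _ → tt)

module MultiTrack (n : ℕ) where

  Word : Set
  Word = List (Fin n)

  Tuple : ℕ → Set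
  Tuple k = Vector Word k

  Column : ℕ → Set
  Column k = Vec (Maybe (Fin n)) k

  MultiDFA : ℕ → Set
  MultiDFA k = DFA (Column k)

  heads : ∀ {k} → Tuple k → Column k
  heads ws = tabulate (head ∘ ws)

  tails : ∀ {k} → Tuple k → Tuple k
  tails = VF.map (drop 1)

  convolve : ∀ {k} → ℕ → Tuple k → List (Column k)
  convolve zero    ws = []
  convolve (suc L) ws = heads ws ∷ convolve L (tails ws)

  width : ∀ {k} → Tuple k → ℕ
  width {zero}  ws = 0
  width {suc k} ws = length (ws zero) ⊔ width (ws ∘ suc)

  width-≥ : ∀ {k} (ws : Tuple k) c → length (ws c) ≤ width ws
  width-≥ ws zero    = m≤m⊔n _ _
  width-≥ ws (suc c) = ≤-trans (width-≥ (ws ∘ suc) c) (m≤n⊔m (length (ws zero)) _)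

  width-≤ : ∀ {k} (ws : Tuple k) L → (∀ c → length (ws c) ≤ L) → width ws ≤ L
  width-≤ {zero}  ws L h = z≤n
  width-≤ {suc k} ws L h = ⊔-lub (h zero) (width-≤ (ws ∘ suc) L (h ∘ suc))

  width-tails : ∀ {k} (ws : Tuple k) → width (tails ws) ≡ width ws ∸ 1
  width-tails {zero}  ws = refl
  width-tails {suc k} ws = begin
    length (drop 1 (ws zero)) ⊔ width (tails (ws ∘ suc))  ≡⟨ cong₂ _⊔_ (length-drop 1 (ws zero)) (width-tails (ws ∘ suc)) ⟩
    (length (ws zero) ∸ 1) ⊔ (width (ws ∘ suc) ∸ 1)       ≡⟨ ∸-distribʳ-⊔ 1 (length (ws zero)) _ ⟨
    width ws ∸ 1                                           ∎
    where open ≡-Reasoning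

  convolve-cong : ∀ {k} L {ws ws′ : Tuple k} → (∀ c → ws c ≡ ws′ c) → convolve L ws ≡ convolve L ws′
  convolve-cong zero    e = refl
  convolve-cong (suc L) e = cong₂ _∷_ (tabulate-cong (cong head ∘ e)) (convolve-cong L (cong (drop 1) ∘ e))

  length-convolve : ∀ {k} L (ws : Tuple k) → length (convolve L ws) ≡ L
  length-convolve zero    ws = refl
  length-convolve (suc L) ws = cong suc (length-convolve L (tails ws))

  accepts : ∀ {k} → MultiDFA k → ℕ → Tuple k → Bool
  accepts M L ws = DFA.accepting M (run M (DFA.start M) (convolve L ws))

  Recognises : ∀ {k} → MultiDFA k → (Tuple k → Set) → Set
  Recognises M R = ∀ ws L → width ws ≤ L → R ws ⇔ T (accepts M L ws)

  Definable : ∀ k → (Tuple k → Set) → Set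
  Definable k R = Σ (MultiDFA k) λ M → Recognises M R

  Definable₂ : (Word → Word → Set) → Set
  Definable₂ R = Definable 2 (λ ws → R (ws zero) (ws (suc zero)))

  Definable₁ : (Word → Set) → Set
  Definable₁ P = Definable 1 (λ ws → P (ws zero))

  decide : ∀ {k R} → Definable k R → ∀ ws → Dec (R ws)
  decide (M , rec) ws = map′ (from (rec ws _ ≤-refl)) (to (rec ws _ ≤-refl)) (T? (accepts M (width ws) ws))

  isPadding : ∀ {k} → Column k → Bool
  isPadding []            = true
  isPadding (nothing ∷ c) = isPadding c
  isPadding (just _ ∷ c)  = false

  heads-padding : ∀ {k} (ws : Tuple k) → width ws ≡ 0 → isPadding (heads ws) ≡ true
  heads-padding {zero}  ws _ = refl
  heads-padding {suc k} ws w≡0 with ws zero | width-≥ ws zero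
  ... | []    | _ = heads-padding (ws ∘ suc) w≡0
  ... | _ ∷ _ | long rewrite w≡0 with long
  ... | ()

  heads-letter : ∀ {k} (ws : Tuple k) {j} → width ws ≡ suc j → isPadding (heads ws) ≡ false
  heads-letter {zero}  ws ()
  heads-letter {suc k} ws w≡suc with ws zero
  ... | []    = heads-letter (ws ∘ suc) w≡suc
  ... | _ ∷ _ = refl

  -- From an automaton that is only correct on exact convolutions (of length
  -- `width ws`) we build one that ignores trailing padding: it runs M and also
  -- saves the state M had after the last non-padding column; it accepts
  -- according to the saved state.
  module Unpadded {k} (M : MultiDFA k) where
    open DFA M
    open ≡-Reasoning
    private
      m = nstates
      pair : Fin m → Fin m → Fin (m * m)
      pair = combine
      saved current : Fin (m * m) → Fin m
      saved   = quotient m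
      current = remainder {m} m

    unpaddedStep : Fin (m * m) → Column k → Fin (m * m)
    unpaddedStep s c = if isPadding c then pair (saved s) (step (current s) c)
                                      else pair (step (current s) c) (step (current s) c)

    unpadded : MultiDFA k
    unpadded = record { nstates = m * m ; start = pair start start ; step = unpaddedStep
                      ; accepting = accepting ∘ saved }

    savedAfter : Fin m → Fin m → ℕ → Tuple k → Fin m
    savedAfter sv cu zero    ws = sv
    savedAfter sv cu (suc j) ws = run M cu (convolve (suc j) ws)

    savedAfter-diagonal : ∀ q j ws → savedAfter q q j ws ≡ run M q (convolve j ws)
    savedAfter-diagonal q zero    ws = refl
    savedAfter-diagonal q (suc j) ws = refl

    private
      step-padding : ∀ sv cu c → isPadding c ≡ true → unpaddedStep (pair sv cu) c ≡ pair sv (step cu c)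
      step-padding sv cu c pad rewrite pad = cong₂ (λ a b → pair a (step b c)) (quotient-combine sv cu) (remainder-combine sv cu)

      step-letter : ∀ sv cu c → isPadding c ≡ false → unpaddedStep (pair sv cu) c ≡ pair (step cu c) (step cu c)
      step-letter sv cu c letter rewrite letter = cong (λ b → pair (step b c) (step b c)) (remainder-combine sv cu)

    saved-run : ∀ L (ws : Tuple k) sv cu → width ws ≤ L →
                saved (run unpadded (pair sv cu) (convolve L ws)) ≡ savedAfter sv cu (width ws) ws
    saved-run zero ws sv cu le rewrite n≤0⇒n≡0 le = quotient-combine sv cu
    saved-run (suc L) ws sv cu le with width ws in eq
    ... | zero = begin
      saved (run unpadded (unpaddedStep (pair sv cu) c) (convolve L (tails ws)))
        ≡⟨ cong (λ s → saved (run unpadded s (convolve L (tails ws)))) (step-padding sv cu c (heads-padding ws eq)) ⟩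
      saved (run unpadded (pair sv (step cu c)) (convolve L (tails ws)))
        ≡⟨ saved-run L (tails ws) sv (step cu c) (subst (_≤ L) (sym tails≡) z≤n) ⟩
      savedAfter sv (step cu c) (width (tails ws)) (tails ws)
        ≡⟨ cong (λ j → savedAfter sv (step cu c) j (tails ws)) tails≡ ⟩
      sv
        ∎
      where
        c = heads ws
        tails≡ : width (tails ws) ≡ 0
        tails≡ = trans (width-tails ws) (cong (_∸ 1) eq)
    ... | suc j = begin
      saved (run unpadded (unpaddedStep (pair sv cu) c) (convolve L (tails ws)))
        ≡⟨ cong (λ s → saved (run unpadded s (convolve L (tails ws)))) (step-letter sv cu c (heads-letter ws eq)) ⟩
      saved (run unpadded (pair cu′ cu′) (convolve L (tails ws)))
        ≡⟨ saved-run L (tails ws) cu′ cu′ (subst (_≤ L) (sym tails≡) (≤-pred le)) ⟩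
      savedAfter cu′ cu′ (width (tails ws)) (tails ws)
        ≡⟨ cong (λ j → savedAfter cu′ cu′ j (tails ws)) tails≡ ⟩
      savedAfter cu′ cu′ j (tails ws)
        ≡⟨ savedAfter-diagonal cu′ j (tails ws) ⟩
      run M cu′ (convolve j (tails ws))
        ∎
      where
        c   = heads ws
        cu′ = step cu c
        tails≡ : width (tails ws) ≡ j
        tails≡ = trans (width-tails ws) (cong (_∸ 1) eq)

    unpadded-recognises : ∀ {R : Tuple k → Set} →
      (∀ ws → R ws ⇔ T (accepting (run M start (convolve (width ws) ws)))) → Recognises unpadded R
    unpadded-recognises exact ws L le =
      subst (λ q → _ ⇔ T (accepting q)) (sym (trans (saved-run L ws start start le) (savedAfter-diagonal start (width ws) ws))) (exact ws)

  module _ {k : ℕ} where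
    infix  7 ¬ᵈ_
    infixr 6 _∧ᵈ_
    infixr 5 _∨ᵈ_

    complement : MultiDFA k → MultiDFA k
    complement M = record M { accepting = not ∘ DFA.accepting M }

    run-complement : ∀ M s (w : List (Column k)) → run (complement M) s w ≡ run M s w
    run-complement M s []      = refl
    run-complement M s (c ∷ w) = run-complement M _ w

    ¬ᵈ_ : ∀ {R} → Definable k R → Definable k (λ ws → ¬ R ws)
    ¬ᵈ (M , rec) = complement M , λ ws L le →
      subst (λ q → _ ⇔ T (not (DFA.accepting M q))) (sym (run-complement M _ (convolve L ws)))
            (⇔-trans (¬-cong-⇔ (rec ws L le)) (⇔-sym (T-not _)))

    product : (Bool → Bool → Bool) → MultiDFA k → MultiDFA k → MultiDFA k
    product f M₁ M₂ = record
      { nstates   = m₁ * m₂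
      ; start     = combine (DFA.start M₁) (DFA.start M₂)
      ; step      = λ s c → combine (DFA.step M₁ (quotient m₂ s) c) (DFA.step M₂ (remainder {m₁} m₂ s) c)
      ; accepting = λ s → f (DFA.accepting M₁ (quotient m₂ s)) (DFA.accepting M₂ (remainder {m₁} m₂ s)) }
      where m₁ = DFA.nstates M₁
            m₂ = DFA.nstates M₂

    run-product : ∀ f M₁ M₂ s₁ s₂ w →
      run (product f M₁ M₂) (combine s₁ s₂) w ≡ combine {DFA.nstates M₁} {DFA.nstates M₂} (run M₁ s₁ w) (run M₂ s₂ w)
    run-product f M₁ M₂ s₁ s₂ []      = refl
    run-product f M₁ M₂ s₁ s₂ (c ∷ w) =
      trans (cong₂ (λ a b → run (product f M₁ M₂) (combine (DFA.step M₁ a c) (DFA.step M₂ b c)) w)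
                   (quotient-combine s₁ s₂) (remainder-combine s₁ s₂))
            (run-product f M₁ M₂ _ _ w)

    accepts-product : ∀ f M₁ M₂ L ws → accepts (product f M₁ M₂) L ws ≡ f (accepts M₁ L ws) (accepts M₂ L ws)
    accepts-product f M₁ M₂ L ws rewrite run-product f M₁ M₂ (DFA.start M₁) (DFA.start M₂) (convolve L ws) =
      cong₂ (λ a b → f (DFA.accepting M₁ a) (DFA.accepting M₂ b)) (quotient-combine s₁ s₂) (remainder-combine s₁ s₂)
      where s₁ = run M₁ (DFA.start M₁) (convolve L ws)
            s₂ = run M₂ (DFA.start M₂) (convolve L ws)

    _∧ᵈ_ : ∀ {R₁ R₂} → Definable k R₁ → Definable k R₂ → Definable k (λ ws → R₁ ws × R₂ ws)
    (M₁ , rec₁) ∧ᵈ (M₂ , rec₂) = product _∧_ M₁ M₂ , λ ws L le →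
      subst (λ b → _ ⇔ T b) (sym (accepts-product _∧_ M₁ M₂ L ws))
            (⇔-trans (rec₁ ws L le ×-⇔ rec₂ ws L le) (⇔-sym T-∧))

    _∨ᵈ_ : ∀ {R₁ R₂} → Definable k R₁ → Definable k R₂ → Definable k (λ ws → R₁ ws ⊎ R₂ ws)
    (M₁ , rec₁) ∨ᵈ (M₂ , rec₂) = product _∨_ M₁ M₂ , λ ws L le →
      subst (λ b → _ ⇔ T b) (sym (accepts-product _∨_ M₁ M₂ L ws))
            (⇔-trans (rec₁ ws L le ⊎-⇔ rec₂ ws L le) (⇔-sym T-∨))

  module _ {k k′ : ℕ} (σ : Fin k → Fin k′) where
    selectColumn : Column k′ → Column k
    selectColumn c = tabulate (lookup c ∘ σ)

    renamed : MultiDFA k → MultiDFA k′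
    renamed M = record { nstates = DFA.nstates M ; start = DFA.start M
                       ; step = λ s c → DFA.step M s (selectColumn c) ; accepting = DFA.accepting M }

    run-renamed : ∀ M s L (ws : Tuple k′) → run (renamed M) s (convolve L ws) ≡ run M s (convolve L (ws ∘ σ))
    run-renamed M s zero    ws = refl
    run-renamed M s (suc L) ws rewrite tabulate-cong (lookup∘tabulate (head ∘ ws) ∘ σ) =
      run-renamed M _ L (tails ws)

    renameᵈ : ∀ {R} → Definable k R → Definable k′ (λ ws → R (ws ∘ σ))
    renameᵈ (M , rec) = renamed M , λ ws L le →
      subst (λ q → _ ⇔ T (DFA.accepting M q)) (sym (run-renamed M _ L ws))
            (rec (ws ∘ σ) L (width-≤ (ws ∘ σ) L (λ c → ≤-trans (width-≥ ws (σ c)) le)))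

  at₂ : ∀ {k} {R : Word → Word → Set} → Definable₂ R →
        (i j : Fin k) → Definable k (λ ws → R (ws i) (ws j))
  at₂ d i j = renameᵈ (i ∷ᵗ j ∷ᵗ VF.[]) d

  at₁ : ∀ {k} {P : Word → Set} → Definable₁ P → (i : Fin k) → Definable k (λ ws → P (ws i))
  at₁ d i = renameᵈ (λ _ → i) d

  -- `withTrack x w` adds x as a new first track to the convolution w, cut at
  -- the length of w (x is padded if shorter).
  withTrack : ∀ {k} → Word → List (Column k) → List (Column (suc k))
  withTrack []      w       = map (nothing ∷_) w
  withTrack (a ∷ x) []      = []
  withTrack (a ∷ x) (c ∷ w) = (just a ∷ c) ∷ withTrack x w

  withTrack-∷ : ∀ {k} x (c : Column k) w → withTrack x (c ∷ w) ≡ (head x ∷ c) ∷ withTrack (drop 1 x) w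
  withTrack-∷ []      c w = refl
  withTrack-∷ (a ∷ x) c w = refl

  convolve-∷ : ∀ {k} L x (ws : Tuple k) → convolve L (x ∷ᵗ ws) ≡ withTrack x (convolve L ws)
  convolve-∷ zero    []      ws = refl
  convolve-∷ zero    (a ∷ x) ws = refl
  convolve-∷ (suc L) x       ws = begin
    heads (x ∷ᵗ ws) ∷ convolve L (tails (x ∷ᵗ ws))                      ≡⟨ cong (_ ∷_) (convolve-cong L tails-∷) ⟩
    heads (x ∷ᵗ ws) ∷ convolve L (drop 1 x ∷ᵗ tails ws)                 ≡⟨ cong (_ ∷_) (convolve-∷ L (drop 1 x) (tails ws)) ⟩
    (head x ∷ heads ws) ∷ withTrack (drop 1 x) (convolve L (tails ws))  ≡⟨ withTrack-∷ x (heads ws) _ ⟨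
    withTrack x (convolve (suc L) ws)                                    ∎
    where
      open ≡-Reasoning
      tails-∷ : ∀ c → tails (x ∷ᵗ ws) c ≡ (drop 1 x ∷ᵗ tails ws) c
      tails-∷ zero    = refl
      tails-∷ (suc c) = refl

  withTrack-[] : ∀ {k} x → withTrack {k} x [] ≡ []
  withTrack-[] []      = refl
  withTrack-[] (a ∷ x) = refl

  withTrack-++ : ∀ {k} x v (w : List (Column k)) → length w ≤ length x → withTrack (x ++ v) w ≡ withTrack x w
  withTrack-++ x       v []      _       = trans (withTrack-[] (x ++ v)) (sym (withTrack-[] x))
  withTrack-++ (a ∷ x) v (c ∷ w) (s≤s h) = cong (_ ∷_) (withTrack-++ x v w h)

  withTrack-take : ∀ {k} x (w : List (Column k)) → length w ≤ length x → withTrack (take (length w) x) w ≡ withTrack x w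
  withTrack-take x       []      _       = sym (withTrack-[] x)
  withTrack-take (a ∷ x) (c ∷ w) (s≤s h) = cong (_ ∷_) (withTrack-take x w h)

  convolve-+ : ∀ {k} L j (ws : Tuple k) → convolve (L + j) ws ≡ convolve L ws ++ convolve j (VF.map (drop L) ws)
  convolve-+ zero    j ws = refl
  convolve-+ (suc L) j ws = cong (_ ∷_) (trans (convolve-+ L j (tails ws)) (cong (convolve L (tails ws) ++_)
                                          (convolve-cong j (λ c → drop-drop 1 L (ws c)))))

  letterColumn : ∀ {k} → Fin n → Column (suc k)
  letterColumn a = just a ∷ tabulate (λ _ → nothing)

  convolve-beyond : ∀ {k} L x (ws : Tuple k) → width ws ≤ L →
                    convolve (length (drop L x)) (VF.map (drop L) (x ∷ᵗ ws)) ≡ map letterColumn (drop L x)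
  convolve-beyond L x ws le = trans (convolve-cong _ dropped) (single (drop L x))
    where
      dropped : ∀ c → VF.map (drop L) (x ∷ᵗ ws) c ≡ (drop L x ∷ᵗ (λ _ → [])) c
      dropped zero    = refl
      dropped (suc c) = drop-all L (ws c) (≤-trans (width-≥ ws c) le)
      single : ∀ y → convolve (length y) (y ∷ᵗ λ _ → []) ≡ map letterColumn y
      single []      = refl
      single (a ∷ y) = cong (_ ∷_) (trans (convolve-cong (length y) tails-single) (single y))
        where
          tails-single : ∀ c → tails ((a ∷ y) ∷ᵗ λ _ → []) c ≡ (y ∷ᵗ λ _ → []) c
          tails-single zero    = refl
          tails-single (suc c) = refl

  -- The automaton guesses the letters of the witness x column by column.  It
  -- tracks two sets of states of M: `live` states, reached while x still had a
  -- letter in every column read so far, and `ended` states, reached after x has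
  -- run out.  At the end it accepts if an ended state is accepting, or if from a
  -- live state M can still accept after reading further letters of x alone
  -- (the witness may be longer than all words of the tuple).
  module Projection {k} (M : MultiDFA (suc k)) where
    open DFA M using () renaming (nstates to m; start to s₀; step to δ; accepting to final)

    readLetters : DFA (Fin n)
    readLetters = record { nstates = m ; start = s₀ ; step = λ q a → δ q (letterColumn a) ; accepting = final }

    run-readLetters : ∀ q v → run readLetters q v ≡ run M q (map letterColumn v)
    run-readLetters q []      = refl
    run-readLetters q (a ∷ v) = run-readLetters (δ q (letterColumn a)) v

    Completable : Fin m → Set
    Completable q = Σ Word λ v → T (final (run M q (map letterColumn v)))

    completable? : ∀ q → Dec (Completable q)
    completable? q = map′ (λ (v , a) → v , subst (T ∘ final) (run-readLetters q v) a)
                          (λ (v , a) → v , subst (T ∘ final) (sym (run-readLetters q v)) a)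
                          (reach? readLetters (T ∘ final) (T? ∘ final) q)

    private
      Sets = 2 ^ m * 2 ^ m

    live ended : Fin Sets → Fin m → Bool
    live  s q = q ∈ˢ quotient (2 ^ m) s
    ended s q = q ∈ˢ remainder {2 ^ m} (2 ^ m) s

    sets : (Fin m → Bool) → (Fin m → Bool) → Fin Sets
    sets F E = combine (encodeSet F) (encodeSet E)

    live-sets : ∀ F E q → live (sets F E) q ≡ F q
    live-sets F E q = trans (cong (q ∈ˢ_) (quotient-combine (encodeSet F) (encodeSet E))) (∈ˢ-encodeSet F q)

    ended-sets : ∀ F E q → ended (sets F E) q ≡ E q
    ended-sets F E q = trans (cong (q ∈ˢ_) (remainder-combine (encodeSet F) (encodeSet E))) (∈ˢ-encodeSet E q)

    LiveStep EndedStep : Fin Sets → Column k → Fin m → Set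
    LiveStep  s c q′ = ∃ λ q → T (live s q) × ∃ λ a → δ q (just a ∷ c) ≡ q′
    EndedStep s c q′ = ∃ λ q → (T (live s q) ⊎ T (ended s q)) × δ q (nothing ∷ c) ≡ q′

    liveNext endedNext : Fin Sets → Column k → Fin m → Bool
    liveNext  s c q′ = isYes (anyFin? λ q → T? (live s q) ×-dec anyFin? λ a → δ q (just a ∷ c) ≟ q′)
    endedNext s c q′ = isYes (anyFin? λ q → (T? (live s q) ⊎-dec T? (ended s q)) ×-dec δ q (nothing ∷ c) ≟ q′)

    guessStep : Fin Sets → Column k → Fin Sets
    guessStep s c = sets (liveNext s c) (endedNext s c)

    Accepting : Fin Sets → Set
    Accepting s = ∃ λ q → (T (ended s q) × T (final q)) ⊎ (T (live s q) × Completable q)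

    guess : MultiDFA k
    guess = record
      { nstates   = Sets
      ; start     = sets (λ q → isYes (q ≟ s₀)) (λ _ → false)
      ; step      = guessStep
      ; accepting = λ s → isYes (anyFin? λ q → (T? (ended s q) ×-dec T? (final q)) ⊎-dec (T? (live s q) ×-dec completable? q)) }

    live-step : ∀ s c q′ → T (live (guessStep s c) q′) ⇔ LiveStep s c q′
    live-step s c q′ rewrite live-sets (liveNext s c) (endedNext s c) q′
      = mk⇔ toWitness fromWitness

    ended-step : ∀ s c q′ → T (ended (guessStep s c) q′) ⇔ EndedStep s c q′
    ended-step s c q′ rewrite ended-sets (liveNext s c) (endedNext s c) q′
      = mk⇔ toWitness fromWitness

    accepting-guess : ∀ s → T (DFA.accepting guess s) ⇔ Accepting s
    accepting-guess s = mk⇔ toWitness fromWitness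

    private
      after : ∀ {q r} (w : List (Column k)) u → r ≡ q → run M r (withTrack u w) ≡ run M q (withTrack u w)
      after w u = cong (λ r → run M r (withTrack u w))

    live-run : ∀ w s q′ → T (live (run guess s w) q′) →
               ∃ λ q → T (live s q) × ∃ λ u → length w ≤ length u × run M q (withTrack u w) ≡ q′
    live-run []      s q′ h = q′ , h , [] , z≤n , refl
    live-run (c ∷ w) s q′ h with live-run w (guessStep s c) q′ h
    ... | q₁ , h₁ , u , le , reach with to (live-step s c q₁) h₁
    ... | q , hq , a , δ≡ = q , hq , a ∷ u , s≤s le , trans (after w u δ≡) reach

    run-live : ∀ w s q u → T (live s q) → length w ≤ length u → T (live (run guess s w) (run M q (withTrack u w)))
    run-live []      s q []      h _        = h
    run-live []      s q (a ∷ u) h _        = h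
    run-live (c ∷ w) s q (a ∷ u) h (s≤s le) = run-live w (guessStep s c) _ u (from (live-step s c _) (q , h , a , refl)) le

    ended-run : ∀ w s q′ → T (ended (run guess s w) q′) →
      (∃ λ q → T (ended s q) × run M q (withTrack [] w) ≡ q′) ⊎
      (∃ λ q → T (live s q) × ∃ λ u → length u < length w × run M q (withTrack u w) ≡ q′)
    ended-run []      s q′ h = inj₁ (q′ , h , refl)
    ended-run (c ∷ w) s q′ h with ended-run w (guessStep s c) q′ h
    ... | inj₁ (q₁ , h₁ , reach) with to (ended-step s c q₁) h₁
    ...   | q , inj₁ live-q  , δ≡ = inj₂ (q , live-q , [] , s≤s z≤n , trans (after w [] δ≡) reach)
    ...   | q , inj₂ ended-q , δ≡ = inj₁ (q , ended-q , trans (after w [] δ≡) reach)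
    ended-run (c ∷ w) s q′ h | inj₂ (q₁ , h₁ , u , lt , reach) with to (live-step s c q₁) h₁
    ... | q , hq , a , δ≡ = inj₂ (q , hq , a ∷ u , s≤s lt , trans (after w u δ≡) reach)

    run-ended : ∀ w s q → T (ended s q) → T (ended (run guess s w) (run M q (withTrack [] w)))
    run-ended []      s q h = h
    run-ended (c ∷ w) s q h = run-ended w (guessStep s c) _ (from (ended-step s c _) (q , inj₂ h , refl))

    run-live-ended : ∀ w s q u → T (live s q) → length u < length w → T (ended (run guess s w) (run M q (withTrack u w)))
    run-live-ended (c ∷ w) s q []      h _        = run-ended w (guessStep s c) _ (from (ended-step s c _) (q , inj₁ h , refl))
    run-live-ended (c ∷ w) s q (a ∷ u) h (s≤s lt) = run-live-ended w (guessStep s c) _ u (from (live-step s c _) (q , h , a , refl)) lt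

    private
      P₀ = DFA.start guess

    live-start : T (live P₀ s₀)
    live-start rewrite live-sets (λ q → isYes (q ≟ s₀)) (λ _ → false) s₀ = fromWitness refl

    live-start-only : ∀ q → T (live P₀ q) → q ≡ s₀
    live-start-only q h rewrite live-sets (λ q → isYes (q ≟ s₀)) (λ _ → false) q = toWitness h

    ¬ended-start : ∀ q → ¬ T (ended P₀ q)
    ¬ended-start q h rewrite ended-sets (λ q → isYes (q ≟ s₀)) (λ _ → false) q = h

    live-reached : ∀ w q → T (live (run guess P₀ w) q) → ∃ λ u → length w ≤ length u × run M s₀ (withTrack u w) ≡ q
    live-reached w q h with live-run w P₀ q h
    ... | q₀ , h₀ , u , le , reach rewrite live-start-only q₀ h₀ = u , le , reach

    ended-reached : ∀ w q → T (ended (run guess P₀ w) q) → ∃ λ u → length u < length w × run M s₀ (withTrack u w) ≡ q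
    ended-reached w q h with ended-run w P₀ q h
    ... | inj₁ (q₀ , h₀ , _) = ⊥-elim (¬ended-start q₀ h₀)
    ... | inj₂ (q₀ , h₀ , u , lt , reach) rewrite live-start-only q₀ h₀ = u , lt , reach

    module _ {R : Tuple (suc k) → Set} (rec : Recognises M R) {ws : Tuple k} {L : ℕ} (le : width ws ≤ L) where
      private
        w = convolve L ws
        |w| : length w ≡ L
        |w| = length-convolve L ws

      short-witness : ∀ x → length x ≤ L → R (x ∷ᵗ ws) ⇔ T (final (run M s₀ (withTrack x w)))
      short-witness x short = subst (λ cs → R (x ∷ᵗ ws) ⇔ T (final (run M s₀ cs))) (convolve-∷ L x ws)
                                    (rec (x ∷ᵗ ws) L (⊔-lub short le))

      long-witness : ∀ x → L ≤ length x →
        R (x ∷ᵗ ws) ⇔ T (final (run M (run M s₀ (withTrack x w)) (map letterColumn (drop L x))))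
      long-witness x long = subst (λ q → _ ⇔ T (final q)) reads (rec (x ∷ᵗ ws) (length x) (⊔-lub ≤-refl (≤-trans le long)))
        where
          open ≡-Reasoning
          rest = drop L x
          |x| : length x ≡ L + length rest
          |x| = sym (trans (cong (L +_) (length-drop L x)) (m+[n∸m]≡n long))
          reads : run M s₀ (convolve (length x) (x ∷ᵗ ws)) ≡ run M (run M s₀ (withTrack x w)) (map letterColumn rest)
          reads = begin
            run M s₀ (convolve (length x) (x ∷ᵗ ws))
              ≡⟨ cong (λ j → run M s₀ (convolve j (x ∷ᵗ ws))) |x| ⟩
            run M s₀ (convolve (L + length rest) (x ∷ᵗ ws))
              ≡⟨ cong (run M s₀) (convolve-+ L (length rest) (x ∷ᵗ ws)) ⟩
            run M s₀ (convolve L (x ∷ᵗ ws) ++ convolve (length rest) (VF.map (drop L) (x ∷ᵗ ws)))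
              ≡⟨ cong₂ (λ a b → run M s₀ (a ++ b)) (convolve-∷ L x ws) (convolve-beyond L x ws le) ⟩
            run M s₀ (withTrack x w ++ map letterColumn rest)
              ≡⟨ run-++ M s₀ (withTrack x w) (map letterColumn rest) ⟩
            run M (run M s₀ (withTrack x w)) (map letterColumn rest)
              ∎

      completed-witness : ∀ u v → L ≤ length u →
        T (final (run M (run M s₀ (withTrack u w)) (map letterColumn v))) → R ((take L u ++ v) ∷ᵗ ws)
      completed-witness u v long accepted =
        from (long-witness x L≤|x|)
             (subst₂ (λ a b → T (final (run M (run M s₀ a) (map letterColumn b)))) (sym track) (sym dropped) accepted)
        where
          x = take L u ++ v
          |take| : length (take L u) ≡ L
          |take| = trans (length-take L u) (m≤n⇒m⊓n≡m long)
          L≤|x| : L ≤ length x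
          L≤|x| = subst (_≤ length x) |take| (length-++-≤ˡ (take L u))
          dropped : drop L x ≡ v
          dropped = subst (λ j → drop j x ≡ v) |take| (drop-++ˡ (take L u) v)
          track : withTrack x w ≡ withTrack u w
          track = trans (withTrack-++ (take L u) v w (≤-reflexive (trans |w| (sym |take|))))
                        (trans (cong (λ j → withTrack (take j u) w) (sym |w|)) (withTrack-take u w (subst (_≤ length u) (sym |w|) long)))

      -- A short witness leaves an accepting ended state, a long one a live
      -- state completed by its remaining letters.
      witness→accepting : (∃ λ x → R (x ∷ᵗ ws)) → Accepting (run guess P₀ w)
      witness→accepting (x , r) with <-≤-connex (length x) L
      ... | inj₁ short = run M s₀ (withTrack x w) ,
            inj₁ (run-live-ended w P₀ s₀ x live-start (subst (length x <_) (sym |w|) short) , to (short-witness x (<⇒≤ short)) r)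
      ... | inj₂ long  = run M s₀ (withTrack x w) ,
            inj₂ (run-live w P₀ s₀ x live-start (subst (_≤ length x) (sym |w|) long) , drop L x , to (long-witness x long) r)

      accepting→witness : Accepting (run guess P₀ w) → ∃ λ x → R (x ∷ᵗ ws)
      accepting→witness (q , inj₁ (ended-q , final-q)) with ended-reached w q ended-q
      ... | u , short , reach = u , from (short-witness u (≤-trans (<⇒≤ short) (≤-reflexive |w|))) (subst (T ∘ final) (sym reach) final-q)
      accepting→witness (q , inj₂ (live-q , v , completes)) with live-reached w q live-q
      ... | u , long , reach = take L u ++ v , completed-witness u v (subst (_≤ length u) |w| long)
                                                 (subst (λ r → T (final (run M r (map letterColumn v)))) (sym reach) completes)

      guess-correct : (∃ λ x → R (x ∷ᵗ ws)) ⇔ T (accepts guess L ws)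
      guess-correct = ⇔-trans (mk⇔ witness→accepting accepting→witness) (⇔-sym (accepting-guess _))

  infix 7 ∃ᵈ_

  ∃ᵈ_ : ∀ {k R} → Definable (suc k) R → Definable k (λ ws → ∃ λ x → R (x ∷ᵗ ws))
  ∃ᵈ (M , rec) = Projection.guess M , λ ws L le → Projection.guess-correct M rec le

  pairTuple : Word → Word → Tuple 2
  pairTuple u v = u ∷ᵗ v ∷ᵗ VF.[]

  tails-pair : ∀ u v c → tails (pairTuple u v) c ≡ pairTuple (drop 1 u) (drop 1 v) c
  tails-pair u v zero       = refl
  tails-pair u v (suc zero) = refl

  twoTrack : DFA (Maybe (Fin n) × Maybe (Fin n)) → MultiDFA 2
  twoTrack D = record { nstates = DFA.nstates D ; start = DFA.start D
                      ; step = λ s c → DFA.step D s (lookup c zero , lookup c (suc zero)) ; accepting = DFA.accepting D }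

  run-twoTrack : ∀ D u v s → run (twoTrack D) s (convolve (length u ⊔ length v) (pairTuple u v)) ≡ run D s (conv u v)
  run-twoTrack D []      []      s = refl
  run-twoTrack D []      (b ∷ v) s = trans (cong (run (twoTrack D) _) (convolve-cong (length v) (tails-pair [] (b ∷ v))))
                                           (run-twoTrack D [] v _)
  run-twoTrack D (a ∷ u) []      s = trans (cong (run (twoTrack D) _) (convolve-cong (length u) (tails-pair (a ∷ u) [])))
                                    (trans (cong (λ j → run (twoTrack D) _ (convolve j (pairTuple u []))) (sym (⊔-identityʳ (length u))))
                                           (run-twoTrack D u [] _))
  run-twoTrack D (a ∷ u) (b ∷ v) s = trans (cong (run (twoTrack D) _) (convolve-cong (length u ⊔ length v) (tails-pair (a ∷ u) (b ∷ v))))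
                                           (run-twoTrack D u v _)

  regularRel→definable : ∀ {R : Word → Word → Set} → RegularRel R → Definable₂ R
  regularRel→definable {R} (D , correct) = Unpadded.unpadded M , Unpadded.unpadded-recognises M exact
    where
      M = twoTrack D
      exact : ∀ ws → R (ws zero) (ws (suc zero)) ⇔ T (DFA.accepting M (run M (DFA.start M) (convolve (width ws) ws)))
      exact ws = subst (λ q → _ ⇔ T (DFA.accepting D q)) (sym reads) (⇔-trans (correct u v) (⇔-sym T-≡))
        where
          u = ws zero
          v = ws (suc zero)
          as-pair : ∀ c → ws c ≡ pairTuple u v c
          as-pair zero       = refl
          as-pair (suc zero) = refl
          reads : run M (DFA.start M) (convolve (width ws) ws) ≡ run D (DFA.start D) (conv u v)
          reads = trans (cong (λ j → run M _ (convolve (length u ⊔ j) ws)) (⊔-identityʳ (length v)))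
                  (trans (cong (run M _) (convolve-cong (length u ⊔ length v) as-pair)) (run-twoTrack D u v _))

  definable→regular : ∀ {P : Word → Set} → Definable₁ P → Regular P
  definable→regular {P} (M , rec) = oneTrack , λ x →
      subst (λ q → P x ⇔ (DFA.accepting M q ≡ true)) (sym (reads (DFA.start M) x))
            (⇔-trans (rec (λ _ → x) (length x) (≤-reflexive (⊔-identityʳ (length x)))) T-≡)
    where
      oneTrack : DFA (Fin n)
      oneTrack = record { nstates = DFA.nstates M ; start = DFA.start M
                        ; step = λ s a → DFA.step M s (just a ∷ []) ; accepting = DFA.accepting M }
      reads : ∀ s x → run oneTrack s x ≡ run M s (convolve (length x) (λ _ → x))
      reads s []      = refl
      reads s (a ∷ x) = reads _ x

module WordRelations (n : ℕ) where
  open MultiTrack n using (Word)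

  Letter² : Set
  Letter² = Maybe (Fin n) × Maybe (Fin n)

  -- The strict lexicographic order (a proper prefix is smaller).
  open StrictTotalOrder (Lex.<-strictTotalOrder (<-strictTotalOrderFin n))
    public using () renaming (_<_ to _<ˡ_; asym to <ˡ-asym; trans to <ˡ-trans; compare to <ˡ-compare)

  <ˡ-irrefl : ∀ {u} → ¬ (u <ˡ u)
  <ˡ-irrefl u<u = <ˡ-asym u<u u<u

  <ˡ-connex : ∀ u v → u ≢ v → u <ˡ v ⊎ v <ˡ u
  <ˡ-connex u v u≢v with <ˡ-compare u v
  ... | tri< u<v _ _ = inj₁ u<v
  ... | tri≈ _ u≋v _ = ⊥-elim (u≢v (Pointwise-≡⇒≡ u≋v))
  ... | tri> _ _ v<u = inj₂ v<u

  -- The lexicographic order is regular: the automaton stays in state 0 while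
  -- the words agree and moves to the absorbing state 1 (smaller) or 2 (greater).
  lexStep : Fin 3 → Letter² → Fin 3
  lexStep zero (nothing , nothing) = zero
  lexStep zero (nothing , just _)  = suc zero
  lexStep zero (just _  , nothing) = suc (suc zero)
  lexStep zero (just a  , just b) with <-cmpFin a b
  ... | tri< _ _ _ = suc zero
  ... | tri≈ _ _ _ = zero
  ... | tri> _ _ _ = suc (suc zero)
  lexStep decided _ = decided

  lexAccept : Fin 3 → Bool
  lexAccept (suc zero) = true
  lexAccept _          = false

  lexDFA : DFA Letter²
  lexDFA = record { nstates = 3 ; start = zero ; step = lexStep ; accepting = lexAccept }

  smaller-accepts : ∀ w → lexAccept (run lexDFA (suc zero) w) ≡ true
  smaller-accepts []      = refl
  smaller-accepts (c ∷ w) = smaller-accepts w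

  greater-rejects : ∀ w → lexAccept (run lexDFA (suc (suc zero)) w) ≢ true
  greater-rejects []      ()
  greater-rejects (c ∷ w) = greater-rejects w

  lex-regular : ∀ u v → u <ˡ v ⇔ Accepts lexDFA (conv u v)
  lex-regular []      []      = mk⇔ (λ { (base ()) }) (λ ())
  lex-regular []      (b ∷ v) = mk⇔ (λ _ → smaller-accepts (conv [] v)) (λ _ → halt)
  lex-regular (a ∷ u) []      = mk⇔ (λ ()) (⊥-elim ∘ greater-rejects (conv u []))
  lex-regular (a ∷ u) (b ∷ v) with <-cmpFin a b
  ... | tri< a<b _ _   = mk⇔ (λ _ → smaller-accepts (conv u v)) (λ _ → this a<b)
  ... | tri> _ a≢b b<a = mk⇔ (λ { (this a<b) → ⊥-elim (<-asymFin a<b b<a) ; (next a≡b _) → ⊥-elim (a≢b a≡b) })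
                             (⊥-elim ∘ greater-rejects (conv u v))
  ... | tri≈ _ refl _  = mk⇔ (λ { (this a<a) → ⊥-elim (<-irreflFin refl a<a) ; (next _ u<v) → to (lex-regular u v) u<v })
                             (λ accepted → next refl (from (lex-regular u v) accepted))

  -- "v has more than N letters more than u" is regular: a counter, saturating at
  -- N + 1, counts the columns in which only v has a letter.
  module Longer (N : ℕ) where
    private
      K = suc N

    Longer : Word → Word → Set
    Longer u v = K ≤ length v ∸ length u

    tick : Fin (suc K) → Fin (suc K)
    tick c = fromℕ< (s≤s (m⊓n≤n (suc (toℕ c)) K))

    tick-value : ∀ c → toℕ (tick c) ≡ suc (toℕ c) ⊓ K
    tick-value c = toℕ-fromℕ< (s≤s (m⊓n≤n (suc (toℕ c)) K))

    countStep : Fin (suc K) → Letter² → Fin (suc K)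
    countStep c (nothing , just _) = tick c
    countStep c _                  = c

    countDFA : DFA Letter²
    countDFA = record { nstates = suc K ; start = zero ; step = countStep ; accepting = λ c → isYes (K ≤? toℕ c) }

    saturate : ∀ a j → (K ≤ a ⊓ K + j) ⇔ (K ≤ a + j)
    saturate a j with a ≤? K
    ... | yes a≤K rewrite m≤n⇒m⊓n≡m a≤K = ⇔-refl
    ... | no  a≰K rewrite m≥n⇒m⊓n≡n (<⇒≤ (≰⇒> a≰K)) =
      mk⇔ (λ _ → ≤-trans (<⇒≤ (≰⇒> a≰K)) (m≤m+n a j)) (λ _ → m≤m+n K j)

    counts : ∀ c u v → T (DFA.accepting countDFA (run countDFA c (conv u v))) ⇔ (K ≤ toℕ c + (length v ∸ length u))
    counts c []      []      = subst (λ j → T (isYes (K ≤? toℕ c)) ⇔ (K ≤ j)) (sym (+-identityʳ (toℕ c))) (mk⇔ toWitness fromWitness)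
    counts c []      (b ∷ v) = ⇔-trans (counts (tick c) [] v) ticked
      where
        ticked : (K ≤ toℕ (tick c) + length v) ⇔ (K ≤ toℕ c + suc (length v))
        ticked = subst₂ (λ t j → (K ≤ t + length v) ⇔ (K ≤ j)) (sym (tick-value c)) (sym (+-suc (toℕ c) (length v)))
                        (saturate (suc (toℕ c)) (length v))
    counts c (a ∷ u) []      = subst (λ j → T (DFA.accepting countDFA (run countDFA c (conv u []))) ⇔ (K ≤ toℕ c + j))
                                     (0∸n≡0 (length u)) (counts c u [])
    counts c (a ∷ u) (b ∷ v) = counts c u v

    longer-regular : ∀ u v → Longer u v ⇔ Accepts countDFA (conv u v)
    longer-regular u v = ⇔-trans (⇔-sym (counts zero u v)) T-≡

  padRight : Fin n → Letter²
  padRight b = (nothing , just b)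

  conv-beyond : ∀ u v w → length u ≡ length v → conv u (v ++ w) ≡ conv u v ++ map padRight w
  conv-beyond []      []      []      _ = refl
  conv-beyond []      []      (b ∷ w) _ = cong (_ ∷_) (conv-beyond [] [] w refl)
  conv-beyond (a ∷ u) (b ∷ v) w       e = cong (_ ∷_) (conv-beyond u v w (suc-injective e))

  module _ (D : DFA Letter²) where
    open DFA D

    readRight : DFA (Fin n)
    readRight = record { nstates = nstates ; start = start ; step = λ s b → step s (padRight b) ; accepting = accepting }

    run-readRight : ∀ s w → run readRight s w ≡ run D s (map padRight w)
    run-readRight s []      = refl
    run-readRight s (b ∷ w) = run-readRight _ w

    pump-right : ∀ u v → Accepts D (conv u v) → suc nstates ≤ length v ∸ length u →
                 ∀ K → ∃ λ v′ → Accepts D (conv u v′) × K ≤ length v′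
    pump-right u v accepted longer K = v₁ ++ v₂′ , subst (λ q → accepting q ≡ true) (sym reads) accepted , long
      where
        open ≡-Reasoning
        u≤v : length u ≤ length v
        u≤v = <⇒≤ (m∸n≢0⇒n<m λ e → case subst (suc nstates ≤_) e longer of λ ())
        v₁ = take (length u) v
        v₂ = drop (length u) v
        |v₁| : length u ≡ length v₁
        |v₁| = sym (trans (length-take (length u) v) (m≤n⇒m⊓n≡m u≤v))
        s₁ = run D start (conv u v₁)
        ℓ : Loop readRight s₁ v₂
        ℓ = loop readRight s₁ v₂ (subst (nstates <_) (sym (length-drop (length u) v)) longer)
        open Loop ℓ
        v₂′ = pre ++ mid ^^ K ++ post
        reads : run D start (conv u (v₁ ++ v₂′)) ≡ run D start (conv u v)
        reads = begin
          run D start (conv u (v₁ ++ v₂′))          ≡⟨ cong (run D start) (conv-beyond u v₁ v₂′ |v₁|) ⟩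
          run D start (conv u v₁ ++ map padRight v₂′) ≡⟨ run-++ D start (conv u v₁) _ ⟩
          run D s₁ (map padRight v₂′)                ≡⟨ run-readRight s₁ v₂′ ⟨
          run readRight s₁ v₂′                       ≡⟨ pump K ⟩
          run readRight s₁ v₂                        ≡⟨ run-readRight s₁ v₂ ⟩
          run D s₁ (map padRight v₂)                 ≡⟨ run-++ D start (conv u v₁) _ ⟨
          run D start (conv u v₁ ++ map padRight v₂) ≡⟨ cong (run D start) (conv-beyond u v₁ v₂ |v₁|) ⟨
          run D start (conv u (v₁ ++ v₂))            ≡⟨ cong (λ x → run D start (conv u x)) (take++drop≡id (length u) v) ⟩
          run D start (conv u v)                     ∎
        long : K ≤ length (v₁ ++ v₂′)
        long = ≤-trans (length-^^ mid K nonempty)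
               (≤-trans (length-++-≤ˡ (mid ^^ K))
               (≤-trans (length-++-≤ʳ (mid ^^ K ++ post) {pre}) (length-++-≤ʳ v₂′ {v₁})))

module _ {X : Set} (R : X → X → Set) (R-trans : ∀ {a b c} → R a b → R b c → R a c)
         {Q : X → Set} (Q? : ∀ x → Dec (Q x)) (R-total : ∀ a b → Q a → Q b → R a b ⊎ R b a) where

  Least : List X → Set
  Least l = Σ X λ c → Q c × (∀ z → z ∈ l → Q z → R c z)

  private
    R-refl : ∀ {a} → Q a → R a a
    R-refl {a} qa = [ (λ r → r) , (λ r → r) ] (R-total a a qa qa)

    keepLesser : ∀ a l → Q a → Least l → Least (a ∷ l)
    keepLesser a l qa (c , qc , c≤) with R-total a c qa qc
    ... | inj₁ a≤c = a , qa , λ { _ (here refl) _ → R-refl qa ; z (there z∈l) qz → R-trans a≤c (c≤ z z∈l qz) }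
    ... | inj₂ c≤a = c , qc , λ { _ (here refl) _ → c≤a ; z (there z∈l) qz → c≤ z z∈l qz }

  least : ∀ l → Any Q l → Least l
  least (a ∷ l) (here qa) with any? Q? l
  ... | yes some = keepLesser a l qa (least l some)
  ... | no  none = a , qa , λ { _ (here refl) _ → R-refl qa ; z (there z∈l) qz → ⊥-elim (none (lose z∈l qz)) }
  least (a ∷ l) (there some) with Q? a
  ... | yes qa  = keepLesser a l qa (least l some)
  ... | no  ¬qa = let (c , qc , c≤) = least l some
                  in c , qc , λ { _ (here refl) qz → ⊥-elim (¬qa qz) ; z (there z∈l) qz → c≤ z z∈l qz }

module _ {X : Set} {Q₁ Q₂ : X → Set} (Q₁? : ∀ x → Dec (Q₁ x)) (Q₂? : ∀ x → Dec (Q₂ x))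
         (Q₁⇒Q₂ : ∀ x → Q₁ x → Q₂ x) where

  count-mono : ∀ l → length (filter Q₁? l) ≤ length (filter Q₂? l)
  count-mono []      = z≤n
  count-mono (x ∷ l) with Q₁? x | Q₂? x
  ... | yes _  | yes _   = s≤s (count-mono l)
  ... | yes q₁ | no  ¬q₂ = ⊥-elim (¬q₂ (Q₁⇒Q₂ x q₁))
  ... | no  _  | yes _   = ≤-trans (count-mono l) (n≤1+n _)
  ... | no  _  | no  _   = count-mono l

  count-strict : ∀ {v} l → v ∈ l → Q₂ v → ¬ Q₁ v → length (filter Q₁? l) < length (filter Q₂? l)
  count-strict (x ∷ l) (here refl) q₂ ¬q₁ with Q₁? x | Q₂? x
  ... | yes q₁ | _       = ⊥-elim (¬q₁ q₁)
  ... | no  _  | yes _   = s≤s (count-mono l)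
  ... | no  _  | no  ¬q₂ = ⊥-elim (¬q₂ q₂)
  count-strict (x ∷ l) (there v∈l) q₂ ¬q₁ with Q₁? x | Q₂? x
  ... | yes _  | yes _   = s≤s (count-strict l v∈l q₂ ¬q₁)
  ... | yes q₁ | no  ¬q₂ = ⊥-elim (¬q₂ (Q₁⇒Q₂ x q₁))
  ... | no  _  | yes _   = ≤-trans (count-strict l v∈l q₂ ¬q₁) (n≤1+n _)
  ... | no  _  | no  _   = count-strict l v∈l q₂ ¬q₁

module TreeFacts {n : ℕ} {T : List (Fin n) → Set} {_≼_ : List (Fin n) → List (Fin n) → Set}
                 (tree : IsTree T _≼_) (_≼?_ : ∀ u v → Dec (u ≼ v)) where
  open IsTree tree renaming (≤-dom to ≼-dom; ≤-refl to ≼-refl; ≤-antisym to ≼-antisym; ≤-trans to ≼-trans)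

  _≟ʷ_ : (u v : List (Fin n)) → Dec (u ≡ v)
  _≟ʷ_ = ≡-dec _≟_

  T-left : ∀ {x y} → x ≼ y → T x
  T-left = proj₁ ∘ ≼-dom

  T-right : ∀ {x y} → x ≼ y → T y
  T-right = proj₂ ∘ ≼-dom

  -- Below every y strictly above x lies an immediate successor of x: the
  -- least node strictly above x and below y.
  successor-below : ∀ {x y} → x ≼ y → x ≢ y → ∃ λ c → ImmSucc T _≼_ x c × c ≼ y
  successor-below {x} {y} x≼y x≢y with preds-finite (T-right x≼y)
  ... | l , complete
    with least _≼_ ≼-trans {Q = λ z → x ≼ z × z ≼ y × x ≢ z} (λ z → (x ≼? z) ×-dec (z ≼? y) ×-dec ¬? (x ≟ʷ z))
               (λ a b (_ , a≼y , _) (_ , b≼y , _) → preds-linear (T-right x≼y) a≼y b≼y)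
               l (lose (complete y (T-right x≼y , ≼-refl (T-right x≼y))) (x≼y , ≼-refl (T-right x≼y) , x≢y))
  ... | c , (x≼c , c≼y , x≢c) , c-least = c , (T-left x≼y , T-right x≼c , x≼c , x≢c , immediate) , c≼y
    where
      immediate : ∀ z → T z → x ≼ z → z ≼ c → z ≡ x ⊎ z ≡ c
      immediate z tz x≼z z≼c with x ≟ʷ z
      ... | yes x≡z = inj₁ (sym x≡z)
      ... | no  x≢z = inj₂ (≼-antisym z≼c (c-least z (complete z (tz , ≼-trans z≼c c≼y)) (x≼z , ≼-trans z≼c c≼y , x≢z)))

  parent-unique : ∀ {p q c} → ImmSucc T _≼_ p c → ImmSucc T _≼_ q c → p ≡ q
  parent-unique (tp , tc , p≼c , p≢c , p-imm) (tq , _ , q≼c , q≢c , q-imm) with preds-linear tc p≼c q≼c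
  ... | inj₁ p≼q = [ sym , (λ q≡c → ⊥-elim (q≢c q≡c)) ] (p-imm _ tq p≼q q≼c)
  ... | inj₂ q≼p = [ (λ p≡q → p≡q) , (λ p≡c → ⊥-elim (p≢c p≡c)) ] (q-imm _ tp q≼p p≼c)

  ¬successor-root : ∀ {p} → ¬ ImmSucc T _≼_ p root
  ¬successor-root (tp , _ , p≼root , p≢root , _) = p≢root (≼-antisym p≼root (root-least tp))

  meet : ∀ {x y} → T x → T y → ∃ λ m → m ≼ x × m ≼ y × (∀ z → z ≼ x → z ≼ y → z ≼ m)
  meet {x} {y} tx ty with preds-finite tx
  ... | l , complete
    with least (λ a b → b ≼ a) (λ a≽b b≽c → ≼-trans b≽c a≽b) {Q = λ z → z ≼ x × z ≼ y} (λ z → (z ≼? x) ×-dec (z ≼? y))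
               (λ a b (a≼x , _) (b≼x , _) → swap (preds-linear tx a≼x b≼x))
               l (lose (complete root (root∈T , root-least tx)) (root-least tx , root-least ty))
  ... | m , (m≼x , m≼y) , m-greatest = m , m≼x , m≼y , λ z z≼x z≼y → m-greatest z (complete z (T-left z≼x , z≼x)) (z≼x , z≼y)

module LeftmostPath (n : ℕ) (T : List (Fin n) → Set) (_≼_ : List (Fin n) → List (Fin n) → Set)
                    (tree : IsTree T _≼_) (≼-regular : RegularRel _≼_)
                    (infinite : InfiniteSet T) (branching : FinitelyBranching T _≼_) where
  open IsTree tree renaming (≤-dom to ≼-dom; ≤-refl to ≼-refl; ≤-antisym to ≼-antisym; ≤-trans to ≼-trans)
  open MultiTrack n
  open WordRelations n

  D : DFA Letter²
  D = proj₁ ≼-regular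

  N : ℕ
  N = DFA.nstates D

  open Longer N

  _≼?_ : ∀ u v → Dec (u ≼ v)
  u ≼? v = decide (regularRel→definable ≼-regular) (pairTuple u v)

  open TreeFacts tree _≼?_

  -- By
  -- pumping, large nodes are exactly those with descendants of every length,
  -- i.e. (as the tree is finitely branching) with infinitely many descendants.
  Large : Word → Set
  Large b = ∃ λ y → b ≼ y × Longer b y

  Unbounded : Word → Set
  Unbounded b = ∀ K → ∃ λ y → b ≼ y × K ≤ length y

  longer-than : ∀ {b y} → suc N + length b ≤ length y → Longer b y
  longer-than {b} {y} long = subst (_≤ length y ∸ length b) (m+n∸n≡m (suc N) (length b)) (∸-monoˡ-≤ (length b) long)

  large-T : ∀ {b} → Large b → T b
  large-T (_ , b≼y , _) = T-left b≼y

  -- The lemmas about large nodes build their witnesses by pumping; they are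
  -- opaque so that case analysis on their results never unfolds those
  -- (very large) terms.  The same holds for the later path lemmas.
  opaque
    large→unbounded : ∀ {b} → Large b → Unbounded b
    large→unbounded {b} (y , b≼y , longer) K with pump-right D b y (to (proj₂ ≼-regular b y) b≼y) longer K
    ... | y′ , accepted , long = y′ , from (proj₂ ≼-regular b y′) accepted , long

    unbounded→large : ∀ {b} → Unbounded b → Large b
    unbounded→large {b} unbounded with unbounded (suc N + length b)
    ... | y , b≼y , long = y , b≼y , longer-than {b} {y} long

    large-down : ∀ {a b} → a ≼ b → Large b → Large a
    large-down a≼b large = unbounded→large λ K → let (y , b≼y , long) = large→unbounded large K in y , ≼-trans a≼b b≼y , long

    -- The root is large because the tree is infinite.
    large-root : Large root
    large-root = unbounded→large λ K →
      let (x , tx , x∉) = infinite (wordsUpTo n K) in x , root-least tx , <⇒≤ (≰⇒> (x∉ ∘ wordsUpTo-complete x K))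

    -- A descendant y longer than x and than all children of x by more than N
    -- letters lies below some child c, which is then large.
    large-successor : ∀ {x} → Large x → ∃ λ c → ImmSucc T _≼_ x c × Large c
    large-successor {x} large with branching x (large-T large)
    ... | children , complete = below (large→unbounded large (suc (length x) + (suc N + bound)))
      where
        bound : ℕ
        bound = length (argmax length [] children)
        below : (∃ λ y → x ≼ y × suc (length x) + (suc N + bound) ≤ length y) → ∃ λ c → ImmSucc T _≼_ x c × Large c
        below (y , x≼y , long) with successor-below x≼y (λ { refl → <⇒≱ long (m≤m+n (length x) _) })
        ... | c , x⋖c , c≼y = c , x⋖c , y , c≼y , longer-than {c} {y} (begin
          suc N + length c                      ≤⟨ +-monoʳ-≤ (suc N) (lookupAll (f[xs]≤f[argmax] [] children) (complete c x⋖c)) ⟩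
          suc N + bound                         ≤⟨ m≤n+m _ (suc (length x)) ⟩
          suc (length x) + (suc N + bound)      ≤⟨ long ⟩
          length y                              ∎)
          where open ≤-Reasoning

  -- Inequality of words is expressed through the lexicographic
  -- order, and the parent relation through the order alone, so that all
  -- notions below are first-order definable from ≼ and <ˡ.
  _≶_ : Word → Word → Set
  u ≶ v = u <ˡ v ⊎ v <ˡ u

  -- p is the parent of a.
  Child : Word → Word → Set
  Child p a = (p ≼ a × p ≶ a) × ¬ (∃ λ z → (p ≼ z × z ≼ a) × (z ≶ p × z ≶ a))

  Siblings : Word → Word → Set
  Siblings a b = a ≶ b × ∃ λ p → Child p a × Child p b

  -- Some ancestor a of x has a large sibling b to its left.
  OffLeft : Word → Set
  OffLeft x = ∃ λ a → ∃ λ b → (a ≼ x × Siblings a b) × (Large b × b <ˡ a)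

  OnPath : Word → Set
  OnPath x = Large x × ¬ OffLeft x

  ≶⇒≢ : ∀ {u v} → u ≶ v → u ≢ v
  ≶⇒≢ (inj₁ u<v) refl = <ˡ-irrefl u<v
  ≶⇒≢ (inj₂ v<u) refl = <ˡ-irrefl v<u

  ≢⇒≶ : ∀ {u v} → u ≢ v → u ≶ v
  ≢⇒≶ {u} {v} = <ˡ-connex u v

  child⇒successor : ∀ {p a} → Child p a → ImmSucc T _≼_ p a
  child⇒successor {p} {a} ((p≼a , p≶a) , no-between) = T-left p≼a , T-right p≼a , p≼a , ≶⇒≢ p≶a , immediate
    where
      immediate : ∀ z → T z → p ≼ z → z ≼ a → z ≡ p ⊎ z ≡ a
      immediate z _ p≼z z≼a with z ≟ʷ p | z ≟ʷ a
      ... | yes z≡p | _       = inj₁ z≡p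
      ... | no  _   | yes z≡a = inj₂ z≡a
      ... | no  z≢p | no  z≢a = ⊥-elim (no-between (z , (p≼z , z≼a) , (≢⇒≶ z≢p , ≢⇒≶ z≢a)))

  successor⇒child : ∀ {p a} → ImmSucc T _≼_ p a → Child p a
  successor⇒child (_ , _ , p≼a , p≢a , immediate) = (p≼a , ≢⇒≶ p≢a) , λ (z , (p≼z , z≼a) , (z≶p , z≶a)) →
    [ ≶⇒≢ z≶p , ≶⇒≢ z≶a ] (immediate z (T-right p≼z) p≼z z≼a)

  onPath-T : ∀ {x} → OnPath x → T x
  onPath-T (large , _) = large-T large

  onPath-down : ∀ {x z} → OnPath x → z ≼ x → OnPath z
  onPath-down (large , ¬off) z≼x =
    large-down z≼x large , λ (a , b , (a≼z , siblings) , left) → ¬off (a , b , (≼-trans a≼z z≼x , siblings) , left)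

  -- The root is on the path: it is large and has no siblings.
  onPath-root : OnPath root
  onPath-root = large-root , λ (a , b , (a≼root , (_ , p , p-a , _)) , _) →
    ¬successor-root (subst (ImmSucc T _≼_ p) (≼-antisym a≼root (root-least (T-left a≼root))) (child⇒successor p-a))

  _≤ˡ_ : Word → Word → Set
  u ≤ˡ v = u ≡ v ⊎ u <ˡ v

  ≤ˡ-trans : ∀ {u v w} → u ≤ˡ v → v ≤ˡ w → u ≤ˡ w
  ≤ˡ-trans (inj₁ refl) v≤w         = v≤w
  ≤ˡ-trans (inj₂ u<v)  (inj₁ refl) = inj₂ u<v
  ≤ˡ-trans (inj₂ u<v)  (inj₂ v<w)  = inj₂ (<ˡ-trans u<v v<w)

  ≤ˡ-total : ∀ u v → u ≤ˡ v ⊎ v ≤ˡ u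
  ≤ˡ-total u v with u ≟ʷ v
  ... | yes u≡v = inj₁ (inj₁ u≡v)
  ... | no  u≢v = [ inj₁ ∘ inj₂ , inj₂ ∘ inj₂ ] (<ˡ-connex u v u≢v)

  -- Only the types of these automata matter, so they are opaque.
  opaque
    ≼ᵈ : ∀ {k} (i j : Fin k) → Definable k (λ ws → ws i ≼ ws j)
    ≼ᵈ = at₂ {R = _≼_} (regularRel→definable ≼-regular)

    <ˡᵈ : ∀ {k} (i j : Fin k) → Definable k (λ ws → ws i <ˡ ws j)
    <ˡᵈ = at₂ {R = _<ˡ_} (regularRel→definable (lexDFA , lex-regular))

    longerᵈ : ∀ {k} (i j : Fin k) → Definable k (λ ws → Longer (ws i) (ws j))
    longerᵈ = at₂ {R = Longer} (regularRel→definable (countDFA , longer-regular))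

    ≶ᵈ : ∀ {k} (i j : Fin k) → Definable k (λ ws → ws i ≶ ws j)
    ≶ᵈ i j = <ˡᵈ i j ∨ᵈ <ˡᵈ j i

    childᵈ : ∀ {k} (i j : Fin k) → Definable k (λ ws → Child (ws i) (ws j))
    childᵈ = at₂ {R = Child} ((≼ᵈ (# 0) (# 1) ∧ᵈ ≶ᵈ (# 0) (# 1)) ∧ᵈ
      ¬ᵈ ∃ᵈ ((≼ᵈ (# 1) (# 0) ∧ᵈ ≼ᵈ (# 0) (# 2)) ∧ᵈ (≶ᵈ (# 0) (# 1) ∧ᵈ ≶ᵈ (# 0) (# 2))))

    largeᵈ : ∀ {k} (i : Fin k) → Definable k (λ ws → Large (ws i))
    largeᵈ = at₁ {P = Large} (∃ᵈ (≼ᵈ (# 1) (# 0) ∧ᵈ longerᵈ (# 1) (# 0)))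

    siblingsᵈ : ∀ {k} (i j : Fin k) → Definable k (λ ws → Siblings (ws i) (ws j))
    siblingsᵈ = at₂ {R = Siblings} (≶ᵈ (# 0) (# 1) ∧ᵈ ∃ᵈ (childᵈ (# 0) (# 1) ∧ᵈ childᵈ (# 0) (# 2)))

    offLeftᵈ : Definable₁ OffLeft
    offLeftᵈ = ∃ᵈ ∃ᵈ ((≼ᵈ (# 1) (# 2) ∧ᵈ siblingsᵈ (# 1) (# 0)) ∧ᵈ (largeᵈ (# 0) ∧ᵈ <ˡᵈ (# 0) (# 1)))

    onPathᵈ : Definable₁ OnPath
    onPathᵈ = largeᵈ (# 0) ∧ᵈ ¬ᵈ offLeftᵈ

  child? : ∀ p a → Dec (Child p a)
  child? p a = decide (childᵈ (# 0) (# 1)) (pairTuple p a)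

  large? : ∀ b → Dec (Large b)
  large? b = decide (largeᵈ {1} (# 0)) (λ _ → b)

  onPath-regular : Regular OnPath
  onPath-regular = definable→regular onPathᵈ

  -- The path continues at the lexicographically least large child of a path node.
  LeftmostLargeChild : Word → Word → Set
  LeftmostLargeChild x c = (Child x c × Large c) × (∀ z → Child x z → Large z → c ≤ˡ z)

  opaque
    leftmost-large-child : ∀ {x} → Large x → ∃ (LeftmostLargeChild x)
    leftmost-large-child {x} large with branching x (large-T large) | large-successor large
    ... | children , complete | c₀ , x⋖c₀ , large-c₀
      with least _≤ˡ_ ≤ˡ-trans {Q = λ c → Child x c × Large c}
                 (λ c → child? x c ×-dec large? c)
                 (λ a b _ _ → ≤ˡ-total a b) children (lose (complete c₀ x⋖c₀) (successor⇒child x⋖c₀ , large-c₀))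
    ... | c , c-large-child , c-least =
      c , c-large-child , λ z x-z large-z → c-least z (complete z (child⇒successor x-z)) (x-z , large-z)

    -- No ancestor of the leftmost large child c has a large sibling to its left:
    -- for the ancestor c itself this is the choice of c, and the ancestors below
    -- c are those of x.
    leftmost-on-path : ∀ {x c} → OnPath x → LeftmostLargeChild x c → OnPath c
    leftmost-on-path {x} {c} (_ , ¬off-x) ((x-c , large-c) , c-least) = large-c , not-off
      where
        x⋖c : ImmSucc T _≼_ x c
        x⋖c = child⇒successor x-c
        not-off : ¬ OffLeft c
        not-off (a , b , (a≼c , siblings@(a≶b , p , p-a , p-b)) , large-b , b<a) with a ≟ʷ c
        ... | yes refl with parent-unique (child⇒successor p-a) x⋖c
        ...   | refl = [ ≶⇒≢ a≶b , (λ c<b → <ˡ-asym c<b b<a) ] (c-least b p-b large-b)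
        not-off (a , b , (a≼c , siblings) , left) | no a≢c with x⋖c
        ... | (_ , _ , x≼c , _ , immediate) with preds-linear (T-right a≼c) a≼c x≼c
        ...   | inj₁ a≼x = ¬off-x (a , b , (a≼x , siblings) , left)
        ...   | inj₂ x≼a = [ (λ a≡x → ¬off-x (a , b , (subst (a ≼_) a≡x (≼-refl (T-left a≼c)) , siblings) , left)) , a≢c ]
                             (immediate a (T-left a≼c) x≼a a≼c)

    path-successor : ∀ {x} → OnPath x → ∃ λ c → OnPath c × x ≼ c × x ≢ c
    path-successor px with leftmost-large-child (proj₁ px)
    ... | c , leftmost@((((x≼c , x≶c) , _) , _) , _) = c , leftmost-on-path px leftmost , x≼c , ≶⇒≢ x≶c

    -- Two path nodes are comparable: otherwise the children of their meet
    -- towards them are siblings, and the one further right is off the path.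
    path-linear : ∀ {x y} → OnPath x → OnPath y → x ≼ y ⊎ y ≼ x
    path-linear {x} {y} px@(large-x , ¬off-x) py@(large-y , ¬off-y) with x ≼? y | y ≼? x
    ... | yes x≼y | _       = inj₁ x≼y
    ... | no  _   | yes y≼x = inj₂ y≼x
    ... | no  x⋠y | no  y⋠x with meet (onPath-T px) (onPath-T py)
    ... | m , m≼x , m≼y , greatest
      with successor-below m≼x (λ { refl → x⋠y m≼y }) | successor-below m≼y (λ { refl → y⋠x m≼x })
    ... | a , m⋖a@(_ , _ , m≼a , m≢a , _) , a≼x | b , m⋖b , b≼y = ⊥-elim ([ off-y , off-x ] (<ˡ-connex a b a≢b))
      where
        a≢b : a ≢ b
        a≢b refl = m≢a (≼-antisym m≼a (greatest a a≼x b≼y))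
        off-y : a <ˡ b → ⊥
        off-y a<b = ¬off-y (b , a , (b≼y , ≢⇒≶ (a≢b ∘ sym) , m , successor⇒child m⋖b , successor⇒child m⋖a) ,
                            large-down a≼x large-x , a<b)
        off-x : b <ˡ a → ⊥
        off-x b<a = ¬off-x (a , b , (a≼x , ≢⇒≶ a≢b , m , successor⇒child m⋖a , successor⇒child m⋖b) ,
                            large-down b≼y large-y , b<a)

  -- Following the path from a path node one eventually leaves the ancestors
  -- of any given node z: each step strictly decreases the number of
  -- predecessors of z lying above the current node.
  Escapes : Word → Word → Set
  Escapes z x = ∃ λ x′ → OnPath x′ × x ≼ x′ × ¬ x′ ≼ z

  module _ (z : Word) (tz : T z) where
    opaque
      below-z : List Word
      below-z = proj₁ (preds-finite tz)

      μ : Word → ℕ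
      μ x = length (filter (x ≼?_) below-z)

      μ-decreasing : ∀ {x c} → x ≼ z → x ≼ c → x ≢ c → μ c < μ x
      μ-decreasing {x} {c} x≼z x≼c x≢c =
        count-strict (c ≼?_) (x ≼?_) (λ w c≼w → ≼-trans x≼c c≼w) below-z
                     (proj₂ (preds-finite tz) x (T-left x≼z , x≼z)) (≼-refl (T-left x≼z)) (λ c≼x → x≢c (≼-antisym x≼c c≼x))

      escapes-above : ∀ x → Acc _<_ (μ x) → OnPath x → Escapes z x
      escapes-above x (acc smaller) px with x ≼? z
      ... | no  x⋠z = x , px , ≼-refl (onPath-T px) , x⋠z
      ... | yes x≼z with path-successor px
      ...   | c , pc , x≼c , x≢c with escapes-above c (smaller (μ-decreasing x≼z x≼c x≢c)) pc
      ...     | x′ , px′ , c≼x′ , x′⋠z = x′ , px′ , ≼-trans x≼c c≼x′ , x′⋠z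

  escapes : ∀ z {x} → OnPath x → Escapes z x
  escapes z {x} px with x ≼? z
  ... | no  x⋠z = x , px , ≼-refl (onPath-T px) , x⋠z
  ... | yes x≼z = escapes-above z (T-right x≼z) x (<-wellFounded _) px

  avoids : ∀ l → ∃ λ x → OnPath x × (∀ z → z ∈ l → ¬ x ≼ z)
  avoids []      = root , onPath-root , λ _ ()
  avoids (z ∷ l) with avoids l
  ... | x , px , x⋠l with escapes z px
  ... | x′ , px′ , x≼x′ , x′⋠z = x′ , px′ , λ
    { _  (here refl)  → x′⋠z
    ; z′ (there z′∈l) x′≼z′ → x⋠l z′ z′∈l (≼-trans x≼x′ x′≼z′) }

  path-infinite : InfiniteSet OnPath
  path-infinite l with avoids l
  ... | x , px , x⋠l = x , px , λ x∈l → x⋠l x x∈l (≼-refl (onPath-T px))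

  -- A node comparable with every path node is on the path: some path node is
  -- not below it, so it lies below that path node.
  path-maximal : ∀ x → T x → (∀ y → OnPath y → x ≼ y ⊎ y ≼ x) → OnPath x
  path-maximal x tx comparable with escapes x onPath-root
  ... | y , py , _ , y⋠x = [ onPath-down py , (λ y≼x → ⊥-elim (y⋠x y≼x)) ] (comparable y py)

  leftmost-path : InfinitePath T _≼_ OnPath
  leftmost-path = record
    { sub      = λ _ → onPath-T
    ; linear   = λ _ _ → path-linear
    ; downward = λ _ _ py _ x≼y → onPath-down py x≼y
    ; maximal  = path-maximal
    ; infinite = path-infinite
    }

corollary6 : (n : ℕ) (T : List (Fin n) → Set) (_≤_ : List (Fin n) → List (Fin n) → Set) →
    IsTree T _≤_ → WordAutomatic T _≤_ → InfiniteSet T → FinitelyBranching T _≤_ →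
    Σ (List (Fin n) → Set) λ P → Regular P × InfinitePath T _≤_ P
corollary6 n T _≤_ tree (_ , ≤-regular) infinite branching =
  OnPath , onPath-regular , leftmost-path
  where open LeftmostPath n T _≤_ tree ≤-regular infinite branching
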